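{- Let $\tau_1=\underline{1}23$. For $n\ge1$ and any integer $k$, let $P_{n,\tau_1,k}(x)=\sum x^{pmp_{\tau_1}(\sigma)}$, the sum over all $\sigma\in S_n$ whose last ascent is at position $k$ (so $P_{n,\tau_1,k}(x)=0$ unless $1\le k\le n-1$; in particular $P_{n,\tau_1,0}=P_{n,\tau_1,n}=0$). Then for all $n\ge2$ and $1\le k\le n-1$, $$P_{n,\tau_1,k}(x)=(k-1)x\,P_{n-1,\tau_1,k-1}(x)+1+\sum_{\ell=1}^{k}P_{n-1,\tau_1,\ell}(x).$$
   Context: A permutation $\sigma\in S_n$ has its last ascent at position $k$ if $\sigma_k<\sigma_{k+1}>\sigma_{k+2}>\cdots>\sigma_n$. For $\sigma\in S_n$, $\sigma$ has a $\underline{1}23$-match at position $\ell$ if there exist $j,m$ with $\ell<j<m$ and $\sigma_\ell<\sigma_j<\sigma_m$; $pmp_{\underline{1}23}(\sigma)$ is the number of such positions $\ell$. -}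

module Defs where

open import Data.Nat using (ℕ; zero; suc; _+_; _*_; _∸_; _≤_; _<_)
open import Data.Nat.Properties using (_≟_; _≤?_; _<?_)
open import Data.List using (List; []; _∷_; length; filter; map; concatMap; applyUpTo; upTo; foldr)
open import Data.List.Relation.Unary.All using (All; all?)
open import Data.List.Relation.Unary.Any using (Any; any?)
open import Data.List.Relation.Unary.Unique.Propositional using (Unique)
open import Data.List.Relation.Unary.Unique.DecPropositional _≟_ using (unique?)
open import Data.Product using (_×_)
open import Relation.Nullary using (Dec)
open import Relation.Nullary.Decidable using (_×-dec_)
open import Relation.Binary.PropositionalEquality using (_≡_)

-- the list [a, a+1, ..., b]  (empty if b < a)
range : ℕ → ℕ → List ℕ
range a b = applyUpTo (a +_) (suc b ∸ a)

words : ℕ → ℕ → List (List ℕ)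
words zero    m = [] ∷ []
words (suc l) m = concatMap (λ w → map (_∷ w) (upTo m)) (words l m)

-- S_n : permutations of {0,...,n-1} in one-line notation
-- (all words of length n over {0..n-1} with pairwise distinct letters)
perms : ℕ → List (List ℕ)
perms n = filter unique? (words n n)

-- σ_i with 1-based positions (value 0 outside 1..length σ, never used there)
at : List ℕ → ℕ → ℕ
at []       _             = 0
at (x ∷ xs) zero          = 0
at (x ∷ xs) (suc zero)    = x
at (x ∷ xs) (suc (suc i)) = at xs (suc i)

LastAscentAt : List ℕ → ℕ → Set
LastAscentAt σ k =
  1 ≤ k × k < length σ × at σ k < at σ (suc k)
  × All (λ i → at σ (suc i) < at σ i) (range (suc k) (length σ ∸ 1))

lastAscentAt? : ∀ σ k → Dec (LastAscentAt σ k)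
lastAscentAt? σ k =
  (1 ≤? k) ×-dec (suc k ≤? length σ) ×-dec (suc (at σ k) ≤? at σ (suc k))
  ×-dec all? (λ i → suc (at σ (suc i)) ≤? at σ i) (range (suc k) (length σ ∸ 1))

Match123 : List ℕ → ℕ → Set
Match123 σ ℓ =
  Any (λ j → Any (λ m → at σ ℓ < at σ j × at σ j < at σ m)
                 (range (suc j) (length σ)))
      (range (suc ℓ) (length σ))

match123? : ∀ σ ℓ → Dec (Match123 σ ℓ)
match123? σ ℓ =
  any? (λ j → any? (λ m → (suc (at σ ℓ) ≤? at σ j) ×-dec (suc (at σ j) ≤? at σ m))
                   (range (suc j) (length σ)))
       (range (suc ℓ) (length σ))

pmp : List ℕ → ℕ
pmp σ = length (filter (match123? σ) (range 1 (length σ)))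

-- Polynomials with ℕ coefficients, as coefficient sequences
Poly : Set
Poly = ℕ → ℕ

_+ₚ_ : Poly → Poly → Poly
(p +ₚ q) j = p j + q j
infixl 6 _+ₚ_

_·ₚ_ : ℕ → Poly → Poly
(c ·ₚ p) j = c * p j
infixl 7 _·ₚ_

X* : Poly → Poly
X* p zero    = 0
X* p (suc j) = p j

1ₚ : Poly
1ₚ zero    = 1
1ₚ (suc j) = 0

0ₚ : Poly
0ₚ _ = 0

Σₚ : List ℕ → (ℕ → Poly) → Poly
Σₚ ls f = foldr (λ ℓ acc → f ℓ +ₚ acc) 0ₚ ls

-- P_{n,τ₁,k}(x) = Σ_{σ ∈ S_n, last ascent at k} x^{pmp(σ)}
-- coefficient of x^j = #{σ ∈ S_n : last ascent at k, pmp(σ) = j}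
P : ℕ → ℕ → Poly
P n k j = length (filter (λ σ → lastAscentAt? σ k ×-dec (pmp σ ≟ j)) (perms n))

_≈ₚ_ : Poly → Poly → Set
p ≈ₚ q = ∀ j → p j ≡ q j
infix 4 _≈ₚ_

{-# OPTIONS --safe #-}
module Submission where

-- Every permutation of {0,…,n} arises exactly once by inserting a new minimum 0 into a permutation σ
-- of {0,…,n−1} (with all entries raised by one) at some position. The inserted 0 is a 1̲23-match iff
-- an ascent of σ lies after it, and no other position changes its status. Hence, for last ascent k:
-- inserting 0 at one of the positions 1,…,k−1 of a σ with last ascent k−1 moves that ascent to k and
-- adds a match, giving (k−1)·x·P_{n−1,k−1}; inserting it at position k makes k the last ascent iff σ
-- decreases from its k-th entry on, i.e. σ is decreasing or has its last ascent at some ℓ < k, giving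
-- 1 + Σ_{ℓ<k} P_{n−1,ℓ}; inserting it at the very end changes nothing, giving P_{n−1,k}; every other
-- position creates a later ascent.

open import Defs
open import Data.Nat
  using (ℕ; zero; suc; _+_; _*_; _∸_; _≤_; _<_; _>_; _≤′_; ≤′-refl; ≤′-step; z≤n; s≤s; s≤s⁻¹; pred)
open import Data.Nat.Properties
  using ( _≟_; _<?_; _>?_; suc-injective; 0≢1+n; +-suc; +-comm; +-assoc; +-identityʳ; *-zeroʳ; ∸-+-assoc
        ; ≤-refl; ≤-trans; ≤-pred; <⇒≤; <-irrefl; <-asym; <-trans; <-cmp; m≤n⇒m≤1+n; ≤∧≢⇒<; ≤⇒≤′; ≤′⇒≤
        ; module ≤-Reasoning)
open import Data.List
  using (List; []; _∷_; [_]; _++_; length; filter; map; concatMap; cartesianProductWith; upTo; applyUpTo; drop)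
open import Data.List.Properties
  using ( length-map; length-++; length-filter; length-applyUpTo; filter-++; filter-none; applyUpTo-∷ʳ
        ; ∷-injective; ∷-injectiveʳ; map-injective; drop-all)
open import Data.List.Membership.Propositional using (_∈_)
open import Data.List.Membership.Propositional.Properties
  using ( ∈-filter⁺; ∈-filter⁻; ∈-map⁺; ∈-map⁻; ∈-++⁺ˡ; ∈-++⁺ʳ; ∈-++⁻; ∈-concat⁺′; ∈-concat⁻′
        ; ∈-upTo⁺; ∈-upTo⁻; ∈-applyUpTo⁺)
open import Data.List.Membership.Propositional.Properties.WithK using (unique∧set⇒bag)
open import Data.List.Relation.Binary.BagAndSetEquality using (∼bag⇒↭)
open import Data.List.Relation.Binary.Permutation.Propositional as ↭ using (_↭_; ↭-sym; ↭⇒↭ₛ)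
open import Data.List.Relation.Binary.Permutation.Propositional.Properties
  using (↭-length; All-resp-↭; Any-resp-↭)
import Data.List.Relation.Binary.Permutation.Setoid.Properties as PermutationSetoid
open import Data.List.Relation.Unary.All as All using (All; []; _∷_)
import Data.List.Relation.Unary.All.Properties as All
open import Data.List.Relation.Unary.Any as Any using (Any; here; there; any?)
import Data.List.Relation.Unary.Any.Properties as Any
open import Data.List.Relation.Unary.AllPairs as AllPairs using ([]; _∷_)
open import Data.List.Relation.Unary.Unique.Propositional using (Unique)
import Data.List.Relation.Unary.Unique.Propositional.Properties as Unique
open import Data.List.Relation.Unary.Unique.DecPropositional _≟_ using (unique?)
open import Data.List.Relation.Unary.Linked as Linked using (Linked; []; [-]; _∷_; linked?)
import Data.List.Relation.Unary.Linked.Properties as Linked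
open import Data.Product using (∃-syntax; _×_; _,_; proj₁; proj₂)
open import Data.Product.Function.NonDependent.Propositional using (_×-⇔_)
open import Data.Sum using (_⊎_; inj₁; inj₂) renaming ([_,_] to [_,_]′)
open import Data.Sum.Function.Propositional using (_⊎-⇔_)
open import Data.Empty using (⊥; ⊥-elim)
open import Function using (_∘_; case_of_; _⇔_; mk⇔; Equivalence)
import Function.Properties.Equivalence as ⇔
open import Level using (0ℓ)
open import Relation.Binary.PropositionalEquality hiding ([_])
open import Relation.Binary.Definitions using (DecidableEquality; tri<; tri≈; tri>)
open import Relation.Nullary using (Dec; yes; no; ¬_)
open import Relation.Nullary.Decidable using (_×-dec_; _⊎-dec_)
open import Relation.Unary using (Pred; Decidable)

open Equivalence using (to; from)

module _ {A : Set} where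

  length-filter-cong : {P Q : Pred A 0ℓ} (P? : Decidable P) (Q? : Decidable Q) (xs : List A) →
    (∀ {x} → x ∈ xs → P x ⇔ Q x) → length (filter P? xs) ≡ length (filter Q? xs)
  length-filter-cong P? Q? [] P⇔Q = refl
  length-filter-cong P? Q? (x ∷ xs) P⇔Q with P? x | Q? x
  ... | yes p | yes q = cong suc (length-filter-cong P? Q? xs (P⇔Q ∘ there))
  ... | no ¬p | no ¬q = length-filter-cong P? Q? xs (P⇔Q ∘ there)
  ... | yes p | no ¬q = ⊥-elim (¬q (to (P⇔Q (here refl)) p))
  ... | no ¬p | yes q = ⊥-elim (¬p (from (P⇔Q (here refl)) q))

  length-filter-empty : {P : Pred A 0ℓ} (P? : Decidable P) (xs : List A) →
    (∀ {x} → x ∈ xs → ¬ P x) → length (filter P? xs) ≡ 0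
  length-filter-empty P? xs ¬P = cong length (filter-none P? (All.tabulate ¬P))

  length-filter-⊎ : {P Q R : Pred A 0ℓ} (R? : Decidable R) (P? : Decidable P) (Q? : Decidable Q) (xs : List A) →
    (∀ {x} → x ∈ xs → R x ⇔ (P x ⊎ Q x)) → (∀ {x} → x ∈ xs → P x → ¬ Q x) →
    length (filter R? xs) ≡ length (filter P? xs) + length (filter Q? xs)
  length-filter-⊎ R? P? Q? [] R⇔P⊎Q disjoint = refl
  length-filter-⊎ R? P? Q? (x ∷ xs) R⇔P⊎Q disjoint
    with R? x | P? x | Q? x | length-filter-⊎ R? P? Q? xs (R⇔P⊎Q ∘ there) (disjoint ∘ there)
  ... | _     | yes p | yes q | _  = ⊥-elim (disjoint (here refl) p q)
  ... | yes r | yes p | no ¬q | ih = cong suc ih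
  ... | yes r | no ¬p | yes q | ih = trans (cong suc ih) (sym (+-suc _ _))
  ... | yes r | no ¬p | no ¬q | _  = ⊥-elim ([ ¬p , ¬q ]′ (to (R⇔P⊎Q (here refl)) r))
  ... | no ¬r | yes p | no ¬q | _  = ⊥-elim (¬r (from (R⇔P⊎Q (here refl)) (inj₁ p)))
  ... | no ¬r | no ¬p | yes q | _  = ⊥-elim (¬r (from (R⇔P⊎Q (here refl)) (inj₂ q)))
  ... | no ¬r | no ¬p | no ¬q | ih = ih

  length-unique-≡ : {xs ys : List A} → Unique xs → Unique ys →
    (∀ {z} → z ∈ xs ⇔ z ∈ ys) → length xs ≡ length ys
  length-unique-≡ xs! ys! xs≈ys = ↭-length (∼bag⇒↭ (unique∧set⇒bag xs! ys! xs≈ys))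

  length-filter-unique-≡ : {P : Pred A 0ℓ} (P? : Decidable P) {xs ys : List A} → Unique xs → Unique ys →
    (∀ {z} → z ∈ xs ⇔ z ∈ ys) → length (filter P? xs) ≡ length (filter P? ys)
  length-filter-unique-≡ P? {xs} {ys} xs! ys! xs≈ys =
    length-unique-≡ (Unique.filter⁺ P? xs!) (Unique.filter⁺ P? ys!) (mk⇔ (restrict xs≈ys) (restrict (⇔.sym xs≈ys)))
    where
    restrict : ∀ {us vs z} → z ∈ us ⇔ z ∈ vs → z ∈ filter P? us → z ∈ filter P? vs
    restrict {us} us≈vs z∈ = let z∈us , Pz = ∈-filter⁻ P? {xs = us} z∈ in ∈-filter⁺ P? (to us≈vs z∈us) Pz

module _ {A : Set} (_≟ᴬ_ : DecidableEquality A) where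
  open import Data.List.Membership.DecPropositional _≟ᴬ_ using (_∈?_)

  unique-⊆⇒length-≤ : {xs ys : List A} → Unique xs → Unique ys →
    (∀ {z} → z ∈ xs → z ∈ ys) → length xs ≤ length ys
  unique-⊆⇒length-≤ {xs} {ys} xs! ys! xs⊆ys = begin
    length xs                     ≡⟨ length-unique-≡ xs! (Unique.filter⁺ (_∈? xs) ys!) xs≈ys∩xs ⟩
    length (filter (_∈? xs) ys)   ≤⟨ length-filter (_∈? xs) ys ⟩
    length ys                     ∎
    where
    open ≤-Reasoning
    xs≈ys∩xs : ∀ {z} → z ∈ xs ⇔ z ∈ filter (_∈? xs) ys
    xs≈ys∩xs = mk⇔ (λ z∈xs → ∈-filter⁺ (_∈? xs) (xs⊆ys z∈xs) z∈xs) (proj₂ ∘ ∈-filter⁻ (_∈? xs) {xs = ys})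

𝟙 : {A : Set} → Dec A → ℕ
𝟙 (yes _) = 1
𝟙 (no _)  = 0

𝟙-cong : {A B : Set} (a? : Dec A) (b? : Dec B) → A ⇔ B → 𝟙 a? ≡ 𝟙 b?
𝟙-cong (yes a) (yes b) A⇔B = refl
𝟙-cong (no ¬a) (no ¬b) A⇔B = refl
𝟙-cong (yes a) (no ¬b) A⇔B = ⊥-elim (¬b (to A⇔B a))
𝟙-cong (no ¬a) (yes b) A⇔B = ⊥-elim (¬a (from A⇔B b))

𝟙-yes : {A : Set} (a? : Dec A) → A → 𝟙 a? ≡ 1
𝟙-yes (yes _) a = refl
𝟙-yes (no ¬a) a = ⊥-elim (¬a a)

𝟙-no : {A : Set} (a? : Dec A) → ¬ A → 𝟙 a? ≡ 0
𝟙-no (yes a) ¬a = ⊥-elim (¬a a)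
𝟙-no (no _)  ¬a = refl

module _ {A : Set} {P : Pred A 0ℓ} (P? : Decidable P) where

  length-filter-∷ : (x : A) (xs : List A) →
    length (filter P? (x ∷ xs)) ≡ 𝟙 (P? x) + length (filter P? xs)
  length-filter-∷ x xs with P? x
  ... | yes _ = refl
  ... | no _  = refl

  length-filter-map : {B : Set} (f : B → A) (xs : List B) →
    length (filter P? (map f xs)) ≡ length (filter (P? ∘ f) xs)
  length-filter-map f [] = refl
  length-filter-map f (x ∷ xs) with P? (f x)
  ... | yes _ = cong suc (length-filter-map f xs)
  ... | no _  = length-filter-map f xs

sumBelow : ℕ → (ℕ → ℕ) → ℕ
sumBelow zero    F = 0
sumBelow (suc m) F = sumBelow m F + F m

sumBelow-const : ∀ (F : ℕ → ℕ) a m → (∀ {i} → i < m → F i ≡ a) → sumBelow m F ≡ m * a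
sumBelow-const F a zero    _      = refl
sumBelow-const F a (suc m) F≡a =
  trans (cong₂ _+_ (sumBelow-const F a m (F≡a ∘ m≤n⇒m≤1+n)) (F≡a ≤-refl)) (+-comm (m * a) a)

sumBelow-zero-tail : ∀ (F : ℕ → ℕ) {m n} → m ≤′ n → (∀ {i} → m ≤ i → i < n → F i ≡ 0) →
  sumBelow n F ≡ sumBelow m F
sumBelow-zero-tail F ≤′-refl                 _  = refl
sumBelow-zero-tail F {m} {suc n} (≤′-step m≤′n) F≡0 = begin
  sumBelow n F + F n
    ≡⟨ cong₂ _+_ (sumBelow-zero-tail F m≤′n (λ m≤i i<n → F≡0 m≤i (m≤n⇒m≤1+n i<n))) (F≡0 (≤′⇒≤ m≤′n) ≤-refl) ⟩
  sumBelow m F + 0    ≡⟨ +-identityʳ _ ⟩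
  sumBelow m F        ∎
  where open ≡-Reasoning

sumBelow-split : ∀ (F : ℕ → ℕ) {k n a b c} → k < n → (∀ {i} → i < k → F i ≡ a) → F k ≡ b →
  (∀ {i} → k < i → i < n → F i ≡ 0) → F n ≡ c → sumBelow (suc n) F ≡ k * a + (b + c)
sumBelow-split F {k} {n} {a} {b} {c} k<n F≡a F≡b F≡0 F≡c = begin
  sumBelow n F + F n            ≡⟨ cong₂ _+_ (sumBelow-zero-tail F (≤⇒≤′ k<n) F≡0) F≡c ⟩
  sumBelow k F + F k + c        ≡⟨ cong (λ s → s + F k + c) (sumBelow-const F a k F≡a) ⟩
  k * a + F k + c               ≡⟨ +-assoc (k * a) (F k) c ⟩
  k * a + (F k + c)             ≡⟨ cong (λ x → k * a + (x + c)) F≡b ⟩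
  k * a + (b + c)               ∎
  where open ≡-Reasoning

Σₚ-range-suc : ∀ (f : ℕ → Poly) t j → Σₚ (range 1 (suc t)) f j ≡ Σₚ (range 1 t) f j + f (suc t) j
Σₚ-range-suc f t j = trans (cong (λ ls → Σₚ ls f j) (sym (applyUpTo-∷ʳ suc t))) (Σₚ-∷ʳ (applyUpTo suc t))
  where
  Σₚ-∷ʳ : ∀ ls → Σₚ (ls ++ [ suc t ]) f j ≡ Σₚ ls f j + f (suc t) j
  Σₚ-∷ʳ []       = +-identityʳ (f (suc t) j)
  Σₚ-∷ʳ (l ∷ ls) = trans (cong (f l j +_) (Σₚ-∷ʳ ls)) (sym (+-assoc (f l j) _ _))

words-as-product : ∀ l m → words (suc l) m ≡ cartesianProductWith (λ w x → x ∷ w) (words l m) (upTo m)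
words-as-product l m = go (words l m)
  where
  go : ∀ ws → concatMap (λ w → map (_∷ w) (upTo m)) ws ≡ cartesianProductWith (λ w x → x ∷ w) ws (upTo m)
  go []       = refl
  go (w ∷ ws) = cong (map (_∷ w) (upTo m) ++_) (go ws)

words-unique : ∀ l m → Unique (words l m)
words-unique zero    m = [] ∷ []
words-unique (suc l) m rewrite words-as-product l m =
  Unique.cartesianProductWith⁺ (λ w x → x ∷ w) (λ eq → let x≡y , w≡v = ∷-injective eq in w≡v , x≡y)
    (words-unique l m) (Unique.upTo⁺ m)

∈-words⁻ : ∀ l m {σ} → σ ∈ words l m → length σ ≡ l × All (_< m) σ
∈-words⁻ zero    m (here refl) = refl , []
∈-words⁻ (suc l) m σ∈ with ∈-concat⁻′ (map (λ w → map (_∷ w) (upTo m)) (words l m)) σ∈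
... | vs , σ∈vs , vs∈ with ∈-map⁻ _ vs∈
...   | w , w∈ , refl with ∈-map⁻ _ σ∈vs
...     | x , x∈ , refl with ∈-words⁻ l m w∈
...       | refl , w<m = refl , ∈-upTo⁻ x∈ ∷ w<m

∈-words⁺ : ∀ l m {σ} → length σ ≡ l → All (_< m) σ → σ ∈ words l m
∈-words⁺ zero    m {[]}    refl []         = here refl
∈-words⁺ (suc l) m {x ∷ σ} refl (x<m ∷ σ<m) =
  ∈-concat⁺′ (∈-map⁺ _ (∈-upTo⁺ x<m)) (∈-map⁺ _ (∈-words⁺ l m refl σ<m))

IsPerm : ℕ → List ℕ → Set
IsPerm n σ = Unique σ × length σ ≡ n × All (_< n) σ

∈-perms : ∀ n {σ} → σ ∈ perms n ⇔ IsPerm n σ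
∈-perms n = mk⇔
  (λ σ∈ → let σ∈words , σ! = ∈-filter⁻ unique? {xs = words n n} σ∈ in σ! , ∈-words⁻ n n σ∈words)
  (λ (σ! , |σ| , σ<n) → ∈-filter⁺ unique? (∈-words⁺ n n |σ| σ<n) σ!)

perms-unique : ∀ n → Unique (perms n)
perms-unique n = Unique.filter⁺ unique? (words-unique n n)

perm-length : ∀ n {σ} → σ ∈ perms n → length σ ≡ n
perm-length n σ∈ = proj₁ (proj₂ (to (∈-perms n) σ∈))

0∈perm : ∀ n {σ} → IsPerm (suc n) σ → 0 ∈ σ
0∈perm n {σ} (σ! , |σ| , σ<n) with any? (0 ≟_) σ
... | yes 0∈σ = 0∈σ
... | no  0∉σ = ⊥-elim (<-irrefl refl (subst (_≤ n) |σ| |σ|≤n))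
  where
  positives! : Unique (applyUpTo suc n)
  positives! = Unique.applyUpTo⁺₁ suc n (λ i<j _ eq → <-irrefl (suc-injective eq) i<j)
  σ⊆positives : ∀ {z} → z ∈ σ → z ∈ applyUpTo suc n
  σ⊆positives {zero}  z∈σ = ⊥-elim (0∉σ z∈σ)
  σ⊆positives {suc z} z∈σ = ∈-applyUpTo⁺ suc (≤-pred (All.lookup σ<n z∈σ))
  |σ|≤n : length σ ≤ n
  |σ|≤n = subst (length σ ≤_) (length-applyUpTo suc n) (unique-⊆⇒length-≤ _≟_ σ! positives! σ⊆positives)

-- Inserting a new minimum

-- the new entry 0 lands at (1-based) position i + 1
ins : ℕ → List ℕ → List ℕ
ins zero    σ       = 0 ∷ map suc σ
ins (suc i) []      = 0 ∷ []
ins (suc i) (x ∷ σ) = suc x ∷ ins i σ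

ins-↭ : ∀ i σ → ins i σ ↭ 0 ∷ map suc σ
ins-↭ zero    σ       = ↭.refl
ins-↭ (suc i) []      = ↭.refl
ins-↭ (suc i) (x ∷ σ) = ↭.trans (↭.prep (suc x) (ins-↭ i σ)) (↭.swap (suc x) 0 ↭.refl)

length-ins : ∀ i σ → length (ins i σ) ≡ suc (length σ)
length-ins i σ = trans (↭-length (ins-↭ i σ)) (cong suc (length-map suc σ))

All-ins : ∀ {P : Pred ℕ 0ℓ} i σ → All P (ins i σ) ⇔ (P 0 × All (P ∘ suc) σ)
All-ins i σ = mk⇔
  (λ Pins → split (All-resp-↭ (ins-↭ i σ) Pins))
  (λ (P0 , Pσ) → All-resp-↭ (↭-sym (ins-↭ i σ)) (P0 ∷ All.map⁺ Pσ))
  where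
  split : ∀ {P : Pred ℕ 0ℓ} {σ} → All P (0 ∷ map suc σ) → P 0 × All (P ∘ suc) σ
  split (P0 ∷ Pσ) = P0 , All.map⁻ Pσ

Any-ins : ∀ {P : Pred ℕ 0ℓ} i σ → Any P (ins i σ) ⇔ (P 0 ⊎ Any (P ∘ suc) σ)
Any-ins i σ = mk⇔
  (λ Pins → case Any-resp-↭ (ins-↭ i σ) Pins of λ where
     (here P0) → inj₁ P0
     (there Pσ) → inj₂ (Any.map⁻ Pσ))
  (λ where
     (inj₁ P0) → Any-resp-↭ (↭-sym (ins-↭ i σ)) (here P0)
     (inj₂ Pσ) → Any-resp-↭ (↭-sym (ins-↭ i σ)) (there (Any.map⁺ Pσ)))

Unique-ins : ∀ i σ → Unique (ins i σ) ⇔ Unique σ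
Unique-ins i σ = mk⇔
  (λ ins! → Unique.map⁻ (AllPairs.tail (Unique-resp-↭ (ins-↭ i σ) ins!)))
  (λ σ! → Unique-resp-↭ (↭-sym (ins-↭ i σ)) (All.map⁺ (All.tabulate (λ _ ())) ∷ Unique.map⁺ suc-injective σ!))
  where
  Unique-resp-↭ : ∀ {xs ys} → xs ↭ ys → Unique xs → Unique ys
  Unique-resp-↭ p = PermutationSetoid.Unique-resp-↭ (setoid ℕ) (↭⇒↭ₛ p)

ins-injectiveʳ : ∀ i {σ τ} → ins i σ ≡ ins i τ → σ ≡ τ
ins-injectiveʳ zero    eq = map-injective suc-injective (∷-injectiveʳ eq)
ins-injectiveʳ (suc i) {[]}    {[]}    eq = refl
ins-injectiveʳ (suc i) {x ∷ σ} {y ∷ τ} eq =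
  let x≡y , σ≡τ = ∷-injective eq in cong₂ _∷_ (suc-injective x≡y) (ins-injectiveʳ i σ≡τ)

ins-injectiveˡ : ∀ i j {σ τ} → i ≤ length σ → j ≤ length τ → ins i σ ≡ ins j τ → i ≡ j
ins-injectiveˡ zero    zero    _ _ _ = refl
ins-injectiveˡ zero    (suc j) {τ = y ∷ τ} _ _ ()
ins-injectiveˡ (suc i) zero    {x ∷ σ} _ _ ()
ins-injectiveˡ (suc i) (suc j) {x ∷ σ} {y ∷ τ} (s≤s i≤) (s≤s j≤) eq =
  cong suc (ins-injectiveˡ i j i≤ j≤ (∷-injectiveʳ eq))

ins-surjective : ∀ {σ} → Unique σ → 0 ∈ σ → ∃[ i ] ∃[ τ ] i ≤ length τ × σ ≡ ins i τ
ins-surjective {x ∷ σ} (x∉σ ∷ _) (here refl) = 0 , map pred σ , z≤n , cong (0 ∷_) (sym (map-suc-pred x∉σ))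
  where
  map-suc-pred : ∀ {σ} → All (0 ≢_) σ → map suc (map pred σ) ≡ σ
  map-suc-pred []                    = refl
  map-suc-pred {zero ∷ σ}  (0≢0 ∷ _) = ⊥-elim (0≢0 refl)
  map-suc-pred {suc y ∷ σ} (_ ∷ ne)  = cong (suc y ∷_) (map-suc-pred ne)
ins-surjective {zero  ∷ σ} (0∉σ ∷ _)  (there 0∈σ) = ⊥-elim (All.lookup 0∉σ 0∈σ refl)
ins-surjective {suc x ∷ σ} (_   ∷ σ!) (there 0∈σ) with ins-surjective σ! 0∈σ
... | i , τ , i≤ , refl = suc i , x ∷ τ , s≤s i≤ , refl

insertions : ℕ → List (List ℕ) → List (List ℕ)
insertions zero    L = []
insertions (suc m) L = insertions m L ++ map (ins m) L

∈-insertions⁻ : ∀ m L {σ} → σ ∈ insertions m L → ∃[ i ] i < m × ∃[ τ ] τ ∈ L × σ ≡ ins i τ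
∈-insertions⁻ (suc m) L σ∈ with ∈-++⁻ (insertions m L) σ∈
... | inj₁ σ∈ᵐ = let i , i<m , rest = ∈-insertions⁻ m L σ∈ᵐ in i , m≤n⇒m≤1+n i<m , rest
... | inj₂ σ∈insₘ = let τ , τ∈ , eq = ∈-map⁻ (ins m) σ∈insₘ in m , ≤-refl , τ , τ∈ , eq

∈-insertions⁺ : ∀ m L {i τ} → i < m → τ ∈ L → ins i τ ∈ insertions m L
∈-insertions⁺ (suc m) L {i} i<1+m τ∈ with i ≟ m
... | yes refl = ∈-++⁺ʳ (insertions m L) (∈-map⁺ (ins m) τ∈)
... | no  i≢m  = ∈-++⁺ˡ (∈-insertions⁺ m L (≤∧≢⇒< (≤-pred i<1+m) i≢m) τ∈)

insertions-unique : ∀ n m → m ≤ suc n → Unique (insertions m (perms n))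
insertions-unique n zero    _     = []
insertions-unique n (suc m) 1+m≤ =
  Unique.++⁺ (insertions-unique n m (m≤n⇒m≤1+n (≤-pred 1+m≤)))
             (Unique.map⁺ (ins-injectiveʳ m) (perms-unique n)) disjoint
  where
  disjoint : ∀ {σ} → ¬ (σ ∈ insertions m (perms n) × σ ∈ map (ins m) (perms n))
  disjoint (σ∈ᵐ , σ∈insₘ) with ∈-insertions⁻ m (perms n) σ∈ᵐ | ∈-map⁻ (ins m) σ∈insₘ
  ... | i , i<m , τ , τ∈ , refl | υ , υ∈ , eq = <-irrefl (ins-injectiveˡ i m i≤ m≤ eq) i<m
    where
    i≤ : i ≤ length τ
    i≤ = subst (i ≤_) (sym (perm-length n τ∈)) (≤-trans (<⇒≤ i<m) (≤-pred 1+m≤))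
    m≤ : m ≤ length υ
    m≤ = subst (m ≤_) (sym (perm-length n υ∈)) (≤-pred 1+m≤)

∈-perms-suc : ∀ n {σ} → σ ∈ perms (suc n) ⇔ σ ∈ insertions (suc n) (perms n)
∈-perms-suc n = mk⇔ to-insertion from-insertion
  where
  to-insertion : ∀ {σ} → σ ∈ perms (suc n) → σ ∈ insertions (suc n) (perms n)
  to-insertion σ∈ with to (∈-perms (suc n)) σ∈
  ... | σ-perm@(σ! , |σ| , σ<1+n) with ins-surjective σ! (0∈perm n σ-perm)
  ... | i , τ , i≤ , refl = ∈-insertions⁺ (suc n) (perms n) (s≤s (subst (i ≤_) |τ| i≤)) τ∈
    where
    |τ| : length τ ≡ n
    |τ| = suc-injective (trans (sym (length-ins i τ)) |σ|)
    τ∈ : τ ∈ perms n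
    τ∈ = from (∈-perms n) (to (Unique-ins i τ) σ! , |τ| , All.map ≤-pred (proj₂ (to (All-ins i τ) σ<1+n)))
  from-insertion : ∀ {σ} → σ ∈ insertions (suc n) (perms n) → σ ∈ perms (suc n)
  from-insertion σ∈ with ∈-insertions⁻ (suc n) (perms n) σ∈
  ... | i , _ , τ , τ∈ , refl =
    let τ! , |τ| , τ<n = to (∈-perms n) τ∈
    in from (∈-perms (suc n)) (from (Unique-ins i τ) τ! , trans (length-ins i τ) (cong suc |τ|) ,
                               from (All-ins i τ) (s≤s z≤n , All.map s≤s τ<n))

#perms : {Q : Pred (List ℕ) 0ℓ} → Decidable Q → ℕ → ℕ
#perms Q? n = length (filter Q? (perms n))

length-filter-insertions : ∀ {Q : Pred (List ℕ) 0ℓ} (Q? : Decidable Q) m L →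
  length (filter Q? (insertions m L)) ≡ sumBelow m (λ i → length (filter (Q? ∘ ins i) L))
length-filter-insertions Q? zero    L = refl
length-filter-insertions Q? (suc m) L = begin
  length (filter Q? (insertions m L ++ map (ins m) L))
    ≡⟨ cong length (filter-++ Q? (insertions m L) (map (ins m) L)) ⟩
  length (filter Q? (insertions m L) ++ filter Q? (map (ins m) L))
    ≡⟨ length-++ (filter Q? (insertions m L)) ⟩
  length (filter Q? (insertions m L)) + length (filter Q? (map (ins m) L))
    ≡⟨ cong₂ _+_ (length-filter-insertions Q? m L) (length-filter-map Q? (ins m) L) ⟩
  sumBelow m (λ i → length (filter (Q? ∘ ins i) L)) + length (filter (Q? ∘ ins m) L) ∎
  where open ≡-Reasoning

#perms-suc : ∀ {Q : Pred (List ℕ) 0ℓ} (Q? : Decidable Q) n →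
  #perms Q? (suc n) ≡ sumBelow (suc n) (λ i → #perms (Q? ∘ ins i) n)
#perms-suc Q? n =
  trans (length-filter-unique-≡ Q? (perms-unique (suc n)) (insertions-unique n (suc n) ≤-refl) (∈-perms-suc n))
        (length-filter-insertions Q? (suc n) (perms n))

#perms-cong : ∀ {Q R : Pred (List ℕ) 0ℓ} (Q? : Decidable Q) (R? : Decidable R) n →
  (∀ {σ} → IsPerm n σ → Q σ ⇔ R σ) → #perms Q? n ≡ #perms R? n
#perms-cong Q? R? n Q⇔R = length-filter-cong Q? R? (perms n) (Q⇔R ∘ to (∈-perms n))

#perms-empty : ∀ {Q : Pred (List ℕ) 0ℓ} (Q? : Decidable Q) n →
  (∀ {σ} → IsPerm n σ → ¬ Q σ) → #perms Q? n ≡ 0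
#perms-empty Q? n ¬Q = length-filter-empty Q? (perms n) (¬Q ∘ to (∈-perms n))

#perms-⊎ : ∀ {Q R S : Pred (List ℕ) 0ℓ} (S? : Decidable S) (Q? : Decidable Q) (R? : Decidable R) n →
  (∀ {σ} → IsPerm n σ → S σ ⇔ (Q σ ⊎ R σ)) → (∀ {σ} → IsPerm n σ → Q σ → ¬ R σ) →
  #perms S? n ≡ #perms Q? n + #perms R? n
#perms-⊎ S? Q? R? n S⇔Q⊎R disjoint =
  length-filter-⊎ S? Q? R? (perms n) (S⇔Q⊎R ∘ to (∈-perms n)) (disjoint ∘ to (∈-perms n))

Decreasing : List ℕ → Set
Decreasing = Linked _>_

decreasing? : Decidable Decreasing
decreasing? = linked? _>?_

LastAscent : List ℕ → ℕ → Set
LastAscent σ           zero          = ⊥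
LastAscent (x ∷ σ)     (suc (suc k)) = LastAscent σ (suc k)
LastAscent (x ∷ y ∷ σ) (suc zero)    = x < y × Decreasing (y ∷ σ)
LastAscent _           _             = ⊥

Contains12 : List ℕ → Set
Contains12 []      = ⊥
Contains12 (y ∷ σ) = Any (y <_) σ ⊎ Contains12 σ

contains12? : Decidable Contains12
contains12? []      = no λ ()
contains12? (y ∷ σ) = any? (y <?_) σ ⊎-dec contains12? σ

Decreasing⇒¬Contains12 : ∀ σ → Decreasing σ → ¬ Contains12 σ
Decreasing⇒¬Contains12 (y ∷ z ∷ σ) (z<y ∷ dec) (inj₁ y<) =
  All.All¬⇒¬Any (All.map (λ w<y y<w → <-asym w<y y<w) (Linked.Linked⇒All >-trans z<y dec)) y<
  where
  >-trans : ∀ {a b c} → a > b → b > c → a > c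
  >-trans b<a c<b = <-trans c<b b<a
Decreasing⇒¬Contains12 (y ∷ σ)     dec         (inj₂ c)  = Decreasing⇒¬Contains12 σ (Linked.tail dec) c

-- x ∷ σ has a 1̲23-match at its first position
HeadMatch : ℕ → List ℕ → Set
HeadMatch x []      = ⊥
HeadMatch x (y ∷ σ) = (x < y × Any (y <_) σ) ⊎ HeadMatch x σ

headMatch? : ∀ x → Decidable (HeadMatch x)
headMatch? x []      = no λ ()
headMatch? x (y ∷ σ) = ((x <? y) ×-dec any? (y <?_) σ) ⊎-dec headMatch? x σ

All-applyUpTo : ∀ {P : Pred ℕ 0ℓ} f n → All P (applyUpTo f n) ⇔ (∀ {i} → i < n → P (f i))
All-applyUpTo f n = mk⇔ (All.applyUpTo⁻ f n) (All.applyUpTo⁺₁ f n)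

Any-at : ∀ {P : Pred ℕ 0ℓ} σ → Any P σ ⇔ (∃[ i ] i < length σ × P (at σ (suc i)))
Any-at []      = mk⇔ (λ ()) (λ ())
Any-at (y ∷ σ) = mk⇔
  (λ where (here p)  → 0 , s≤s z≤n , p
           (there p) → let i , i< , q = to (Any-at σ) p in suc i , s≤s i< , q)
  (λ where (zero  , _ , p)       → here p
           (suc i , s≤s i< , p) → there (from (Any-at σ) (i , i< , p)))

length-filter-applyUpTo : ∀ {P Q : Pred ℕ 0ℓ} (P? : Decidable P) (Q? : Decidable Q) f g n →
  (∀ i → P (f i) ⇔ Q (g i)) → length (filter P? (applyUpTo f n)) ≡ length (filter Q? (applyUpTo g n))
length-filter-applyUpTo P? Q? f g zero    P⇔Q = refl
length-filter-applyUpTo P? Q? f g (suc n) P⇔Q = begin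
  length (filter P? (applyUpTo f (suc n)))             ≡⟨ length-filter-∷ P? (f 0) _ ⟩
  𝟙 (P? (f 0)) + length (filter P? (applyUpTo (f ∘ suc) n))
    ≡⟨ cong₂ _+_ (𝟙-cong (P? (f 0)) (Q? (g 0)) (P⇔Q 0))
                 (length-filter-applyUpTo P? Q? (f ∘ suc) (g ∘ suc) n (P⇔Q ∘ suc)) ⟩
  𝟙 (Q? (g 0)) + length (filter Q? (applyUpTo (g ∘ suc) n)) ≡⟨ length-filter-∷ Q? (g 0) _ ⟨
  length (filter Q? (applyUpTo g (suc n)))             ∎
  where open ≡-Reasoning

-- Match123 σ ℓ with the positions ℓ < ℓ+1+i < ℓ+2+i+i′ made explicit
MatchAt : List ℕ → ℕ → Set
MatchAt σ ℓ = ∃[ i ] i < length σ ∸ ℓ × ∃[ i′ ] i′ < length σ ∸ (suc ℓ + i) ×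
  (at σ ℓ < at σ (suc ℓ + i) × at σ (suc ℓ + i) < at σ (suc (suc ℓ + i) + i′))

Match123⇔MatchAt : ∀ σ ℓ → Match123 σ ℓ ⇔ MatchAt σ ℓ
Match123⇔MatchAt σ ℓ = mk⇔
  (λ m → let i , i< , m′ = Any.applyUpTo⁻ (suc ℓ +_) m
             i′ , i′< , c = Any.applyUpTo⁻ (suc (suc ℓ + i) +_) m′
         in i , i< , i′ , i′< , c)
  (λ (i , i< , i′ , i′< , c) → Any.applyUpTo⁺ (suc ℓ +_) (Any.applyUpTo⁺ (suc (suc ℓ + i) +_) c i′<) i<)

-- MatchAt (x ∷ σ) (2 + ℓ) and MatchAt σ (1 + ℓ) are the same type by computation of at
Match123-∷ : ∀ x σ ℓ → Match123 (x ∷ σ) (suc (suc ℓ)) ⇔ Match123 σ (suc ℓ)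
Match123-∷ x σ ℓ = ⇔.trans (Match123⇔MatchAt (x ∷ σ) (suc (suc ℓ))) (⇔.sym (Match123⇔MatchAt σ (suc ℓ)))

HeadMatch⇔MatchAt : ∀ x σ → HeadMatch x σ ⇔ MatchAt (x ∷ σ) 1
HeadMatch⇔MatchAt x []      = mk⇔ (λ ()) (λ ())
HeadMatch⇔MatchAt x (y ∷ σ) = mk⇔
  (λ where (inj₁ (x<y , y<σ)) → let i′ , i′< , y< = to (Any-at σ) y<σ in 0 , s≤s z≤n , i′ , i′< , x<y , y<
           (inj₂ m) → let i , i< , rest = to (HeadMatch⇔MatchAt x σ) m in suc i , s≤s i< , rest)
  (λ where (zero , _ , i′ , i′< , x<y , y<) → inj₁ (x<y , from (Any-at σ) (i′ , i′< , y<))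
           (suc i , s≤s i< , rest)         → inj₂ (from (HeadMatch⇔MatchAt x σ) (i , i< , rest)))

pmp-∷ : ∀ x σ → pmp (x ∷ σ) ≡ 𝟙 (headMatch? x σ) + pmp σ
pmp-∷ x σ = begin
  pmp (x ∷ σ)                                        ≡⟨ length-filter-∷ (match123? (x ∷ σ)) 1 _ ⟩
  𝟙 (match123? (x ∷ σ) 1) + length (filter (match123? (x ∷ σ)) (applyUpTo (suc ∘ suc) (length σ)))
    ≡⟨ cong₂ _+_ (𝟙-cong _ _ head) (length-filter-applyUpTo _ _ (suc ∘ suc) suc (length σ) (Match123-∷ x σ)) ⟩
  𝟙 (headMatch? x σ) + pmp σ                         ∎
  where
  open ≡-Reasoning
  head : Match123 (x ∷ σ) 1 ⇔ HeadMatch x σ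
  head = ⇔.trans (Match123⇔MatchAt (x ∷ σ) 1) (⇔.sym (HeadMatch⇔MatchAt x σ))

Decreasing-at : ∀ y σ →
  Decreasing (y ∷ σ) ⇔ (∀ {j} → j < length σ → at (y ∷ σ) (suc (suc j)) < at (y ∷ σ) (suc j))
Decreasing-at y []      = mk⇔ (λ _ ()) (λ _ → [-])
Decreasing-at y (z ∷ σ) = mk⇔
  (λ where (z<y ∷ _)   {zero}  _        → z<y
           (_   ∷ dec) {suc j} (s≤s j<) → to (Decreasing-at z σ) dec j<)
  (λ desc → desc (s≤s z≤n) ∷ from (Decreasing-at z σ) (desc ∘ s≤s))

LastAscentAt-1 : ∀ x y σ → LastAscentAt (x ∷ y ∷ σ) 1 ⇔ (x < y × Decreasing (y ∷ σ))
LastAscentAt-1 x y σ = mk⇔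
  (λ (_ , _ , x<y , desc) → x<y , from (Decreasing-at y σ) (to (All-applyUpTo (2 +_) (length σ)) desc))
  (λ (x<y , dec) → s≤s z≤n , s≤s (s≤s z≤n) , x<y ,
                   from (All-applyUpTo (2 +_) (length σ)) (to (Decreasing-at y σ) dec))

LastAscentAt-∷ : ∀ x σ k → LastAscentAt (x ∷ σ) (suc (suc k)) ⇔ LastAscentAt σ (suc k)
LastAscentAt-∷ x σ k = mk⇔
  (λ where (_ , s≤s k< , asc , desc) → s≤s z≤n , k< , asc , from (All-applyUpTo (2 + k +_) _)
             (λ {i} i< → to (All-applyUpTo (3 + k +_) _) desc (subst (i <_) tail-length i<)))
  (λ (_ , k< , asc , desc) → s≤s z≤n , s≤s k< , asc , from (All-applyUpTo (3 + k +_) _)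
     (λ {i} i< → to (All-applyUpTo (2 + k +_) _) desc (subst (i <_) (sym tail-length) i<)))
  where
  tail-length : (length σ ∸ 1) ∸ suc k ≡ length σ ∸ suc (suc k)
  tail-length = ∸-+-assoc (length σ) 1 (suc k)

LastAscentAt⇔LastAscent : ∀ σ k → LastAscentAt σ k ⇔ LastAscent σ k
LastAscentAt⇔LastAscent σ           zero          = mk⇔ (λ ()) (λ ())
LastAscentAt⇔LastAscent []          (suc zero)    = mk⇔ (λ ()) (λ ())
LastAscentAt⇔LastAscent (x ∷ [])    (suc zero)    = mk⇔ (λ { (_ , s≤s () , _) }) (λ ())
LastAscentAt⇔LastAscent (x ∷ y ∷ σ) (suc zero)    = LastAscentAt-1 x y σ
LastAscentAt⇔LastAscent []          (suc (suc k)) = mk⇔ (λ ()) (λ ())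
LastAscentAt⇔LastAscent (x ∷ σ)     (suc (suc k)) =
  ⇔.trans (LastAscentAt-∷ x σ k) (LastAscentAt⇔LastAscent σ (suc k))

-- Effect of the insertion on matches and on the last ascent

suc-<-suc : ∀ {x y} → suc x < suc y ⇔ x < y
suc-<-suc = mk⇔ s≤s⁻¹ s≤s

Any-<-map-suc : ∀ y σ → Any (suc y <_) (map suc σ) ⇔ Any (y <_) σ
Any-<-map-suc y σ = mk⇔ (Any.map s≤s⁻¹ ∘ Any.map⁻) (Any.map⁺ ∘ Any.map s≤s)

Any-<-ins : ∀ y i σ → Any (suc y <_) (ins i σ) ⇔ Any (y <_) σ
Any-<-ins y i σ =
  ⇔.trans (Any-ins i σ) (mk⇔ (λ { (inj₁ ()) ; (inj₂ y<σ) → Any.map s≤s⁻¹ y<σ }) (inj₂ ∘ Any.map s≤s))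

HeadMatch-map-suc : ∀ x σ → HeadMatch (suc x) (map suc σ) ⇔ HeadMatch x σ
HeadMatch-map-suc x []      = ⇔.refl
HeadMatch-map-suc x (y ∷ σ) = (suc-<-suc ×-⇔ Any-<-map-suc y σ) ⊎-⇔ HeadMatch-map-suc x σ

HeadMatch-ins : ∀ x i σ → HeadMatch (suc x) (ins i σ) ⇔ HeadMatch x σ
HeadMatch-ins x zero    σ       = mk⇔ (λ { (inj₁ (() , _)) ; (inj₂ m) → to (HeadMatch-map-suc x σ) m })
                                      (inj₂ ∘ from (HeadMatch-map-suc x σ))
HeadMatch-ins x (suc i) []      = mk⇔ (λ { (inj₁ (() , _)) ; (inj₂ ()) }) (λ ())
HeadMatch-ins x (suc i) (y ∷ σ) = (suc-<-suc ×-⇔ Any-<-ins y i σ) ⊎-⇔ HeadMatch-ins x i σ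

HeadMatch-0-map-suc : ∀ σ → HeadMatch 0 (map suc σ) ⇔ Contains12 σ
HeadMatch-0-map-suc []      = ⇔.refl
HeadMatch-0-map-suc (y ∷ σ) =
  mk⇔ (to (Any-<-map-suc y σ) ∘ proj₂) ((s≤s z≤n ,_) ∘ from (Any-<-map-suc y σ)) ⊎-⇔ HeadMatch-0-map-suc σ

pmp-map-suc : ∀ σ → pmp (map suc σ) ≡ pmp σ
pmp-map-suc []      = refl
pmp-map-suc (x ∷ σ) = begin
  pmp (suc x ∷ map suc σ)                                ≡⟨ pmp-∷ (suc x) (map suc σ) ⟩
  𝟙 (headMatch? (suc x) (map suc σ)) + pmp (map suc σ)
    ≡⟨ cong₂ _+_ (𝟙-cong (headMatch? (suc x) (map suc σ)) (headMatch? x σ) (HeadMatch-map-suc x σ))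
                 (pmp-map-suc σ) ⟩
  𝟙 (headMatch? x σ) + pmp σ                             ≡⟨ pmp-∷ x σ ⟨
  pmp (x ∷ σ)                                            ∎
  where open ≡-Reasoning

pmp-ins : ∀ i σ → pmp (ins i σ) ≡ pmp σ + 𝟙 (contains12? (drop i σ))
pmp-ins zero σ = begin
  pmp (0 ∷ map suc σ)                                    ≡⟨ pmp-∷ 0 (map suc σ) ⟩
  𝟙 (headMatch? 0 (map suc σ)) + pmp (map suc σ)
    ≡⟨ cong₂ _+_ (𝟙-cong (headMatch? 0 (map suc σ)) (contains12? σ) (HeadMatch-0-map-suc σ))
                 (pmp-map-suc σ) ⟩
  𝟙 (contains12? σ) + pmp σ                              ≡⟨ +-comm _ (pmp σ) ⟩
  pmp σ + 𝟙 (contains12? σ)                              ∎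
  where open ≡-Reasoning
pmp-ins (suc i) []      = refl
pmp-ins (suc i) (x ∷ σ) = begin
  pmp (suc x ∷ ins i σ)                                  ≡⟨ pmp-∷ (suc x) (ins i σ) ⟩
  𝟙 (headMatch? (suc x) (ins i σ)) + pmp (ins i σ)
    ≡⟨ cong₂ _+_ (𝟙-cong (headMatch? (suc x) (ins i σ)) (headMatch? x σ) (HeadMatch-ins x i σ))
                 (pmp-ins i σ) ⟩
  𝟙 (headMatch? x σ) + (pmp σ + 𝟙 (contains12? (drop i σ)))
    ≡⟨ +-assoc (𝟙 (headMatch? x σ)) (pmp σ) _ ⟨
  𝟙 (headMatch? x σ) + pmp σ + 𝟙 (contains12? (drop i σ))   ≡⟨ cong (_+ _) (pmp-∷ x σ) ⟨
  pmp (x ∷ σ) + 𝟙 (contains12? (drop i σ))               ∎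
  where open ≡-Reasoning

pmp-ins-decreasing : ∀ i σ → Decreasing (drop i σ) → pmp (ins i σ) ≡ pmp σ
pmp-ins-decreasing i σ dec = begin
  pmp (ins i σ)                            ≡⟨ pmp-ins i σ ⟩
  pmp σ + 𝟙 (contains12? (drop i σ))
    ≡⟨ cong (pmp σ +_) (𝟙-no (contains12? (drop i σ)) (Decreasing⇒¬Contains12 (drop i σ) dec)) ⟩
  pmp σ + 0                                ≡⟨ +-identityʳ (pmp σ) ⟩
  pmp σ                                    ∎
  where open ≡-Reasoning

pmp-ins-end : ∀ σ → pmp (ins (length σ) σ) ≡ pmp σ
pmp-ins-end σ = pmp-ins-decreasing (length σ) σ (subst Decreasing (sym (drop-all (length σ) σ ≤-refl)) [])

pmp-ins-end-≡ : ∀ σ j → pmp (ins (length σ) σ) ≡ j ⇔ pmp σ ≡ j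
pmp-ins-end-≡ σ j = mk⇔ (trans (sym (pmp-ins-end σ))) (trans (pmp-ins-end σ))

Decreasing-map-suc : ∀ σ → Decreasing (map suc σ) ⇔ Decreasing σ
Decreasing-map-suc σ = mk⇔ (Linked.map s≤s⁻¹ ∘ Linked.map⁻) (Linked.map⁺ ∘ Linked.map s≤s)

¬Decreasing-ins : ∀ i σ → i < length σ → ¬ Decreasing (ins i σ)
¬Decreasing-ins zero    (y ∷ σ) _        (() ∷ _)
¬Decreasing-ins (suc i) (x ∷ σ) (s≤s i<) dec = ¬Decreasing-ins i σ i< (Linked.tail dec)

Decreasing-ins-end : ∀ σ → Decreasing (ins (length σ) σ) ⇔ Decreasing σ
Decreasing-ins-end []          = mk⇔ (λ _ → []) (λ _ → [-])
Decreasing-ins-end (y ∷ [])    = mk⇔ (λ _ → [-]) (λ _ → s≤s z≤n ∷ [-])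
Decreasing-ins-end (y ∷ z ∷ σ) with Decreasing-ins-end (z ∷ σ)
... | ih = mk⇔ (λ { (s≤s z<y ∷ dec) → z<y ∷ to ih dec })
               (λ { (z<y ∷ dec) → s≤s z<y ∷ from ih dec })

LastAscent-map-suc : ∀ σ k → LastAscent (map suc σ) k ⇔ LastAscent σ k
LastAscent-map-suc σ           zero          = ⇔.refl
LastAscent-map-suc []          (suc k)       = ⇔.refl
LastAscent-map-suc (x ∷ σ)     (suc (suc k)) = LastAscent-map-suc σ (suc k)
LastAscent-map-suc (x ∷ [])    (suc zero)    = ⇔.refl
LastAscent-map-suc (x ∷ y ∷ σ) (suc zero)    = suc-<-suc ×-⇔ Decreasing-map-suc (y ∷ σ)

LastAscent-ins-before : ∀ i σ k → i < k → LastAscent (ins i σ) (suc k) ⇔ LastAscent σ k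
LastAscent-ins-before zero    σ       (suc k)       _        = LastAscent-map-suc σ (suc k)
LastAscent-ins-before (suc i) []      (suc zero)    (s≤s ())
LastAscent-ins-before (suc i) []      (suc (suc k)) _        = ⇔.refl
LastAscent-ins-before (suc i) (x ∷ σ) (suc (suc k)) (s≤s i<) = LastAscent-ins-before i σ (suc k) i<

LastAscent⇒Contains12-drop : ∀ σ k i → LastAscent σ k → i < k → Contains12 (drop i σ)
LastAscent⇒Contains12-drop (x ∷ y ∷ σ) (suc zero)    zero    (x<y , _) _        = inj₁ (here x<y)
LastAscent⇒Contains12-drop (x ∷ y ∷ σ) (suc zero)    (suc i) _         (s≤s ())
LastAscent⇒Contains12-drop (x ∷ σ)     (suc (suc k)) zero    la        _        =
  inj₂ (LastAscent⇒Contains12-drop σ (suc k) zero la (s≤s z≤n))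
LastAscent⇒Contains12-drop (x ∷ σ)     (suc (suc k)) (suc i) la        (s≤s i<) =
  LastAscent⇒Contains12-drop σ (suc k) i la i<

pmp-ins-before : ∀ {σ k i} → LastAscent σ k → i < k → pmp (ins i σ) ≡ suc (pmp σ)
pmp-ins-before {σ} {k} {i} la i<k = begin
  pmp (ins i σ)                            ≡⟨ pmp-ins i σ ⟩
  pmp σ + 𝟙 (contains12? (drop i σ))
    ≡⟨ cong (pmp σ +_) (𝟙-yes (contains12? (drop i σ)) (LastAscent⇒Contains12-drop σ k i la i<k)) ⟩
  pmp σ + 1                                ≡⟨ +-comm (pmp σ) 1 ⟩
  suc (pmp σ)                              ∎
  where open ≡-Reasoning

LastAscent-ins-at : ∀ i σ → i < length σ → LastAscent (ins i σ) (suc i) ⇔ Decreasing (drop i σ)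
LastAscent-ins-at zero    (y ∷ σ) _        =
  mk⇔ (to (Decreasing-map-suc (y ∷ σ)) ∘ proj₂) ((s≤s z≤n ,_) ∘ from (Decreasing-map-suc (y ∷ σ)))
LastAscent-ins-at (suc i) (x ∷ σ) (s≤s i<) = LastAscent-ins-at i σ i<

¬LastAscent-ins-after : ∀ k i σ → k ≤ i → i < length σ → ¬ LastAscent (ins i σ) k
¬LastAscent-ins-after (suc zero)    (suc i) (x ∷ σ) _        (s≤s i<) la =
  ¬Decreasing-ins i σ i< (tail-decreasing (ins i σ) la)
  where
  tail-decreasing : ∀ τ → LastAscent (suc x ∷ τ) 1 → Decreasing τ
  tail-decreasing (y ∷ τ) (_ , dec) = dec
¬LastAscent-ins-after (suc (suc k)) (suc i) (x ∷ σ) (s≤s k≤) (s≤s i<) la =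
  ¬LastAscent-ins-after (suc k) i σ k≤ i< la

LastAscent-ins-end : ∀ σ k → LastAscent (ins (length σ) σ) k ⇔ LastAscent σ k
LastAscent-ins-end σ           zero          = ⇔.refl
LastAscent-ins-end []          (suc zero)    = ⇔.refl
LastAscent-ins-end []          (suc (suc k)) = ⇔.refl
LastAscent-ins-end (x ∷ [])    (suc zero)    = mk⇔ (λ { (() , _) }) (λ ())
LastAscent-ins-end (x ∷ y ∷ σ) (suc zero)    = suc-<-suc ×-⇔ Decreasing-ins-end (y ∷ σ)
LastAscent-ins-end (x ∷ σ)     (suc (suc k)) = LastAscent-ins-end σ (suc k)

Decreasing-drop-suc : ∀ k σ → Unique σ →
  Decreasing (drop (suc k) σ) ⇔ (Decreasing (drop k σ) ⊎ LastAscent σ (suc k))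
Decreasing-drop-suc zero    []          _ = mk⇔ inj₁ (λ { (inj₁ dec) → dec ; (inj₂ ()) })
Decreasing-drop-suc (suc k) []          _ = mk⇔ inj₁ (λ { (inj₁ dec) → dec ; (inj₂ ()) })
Decreasing-drop-suc zero    (x ∷ [])    _ = mk⇔ (λ _ → inj₁ [-]) (λ _ → [])
Decreasing-drop-suc zero    (x ∷ y ∷ σ) ((x≢y ∷ _) ∷ _) =
  mk⇔ split (λ { (inj₁ dec) → Linked.tail dec ; (inj₂ (_ , dec)) → dec })
  where
  split : Decreasing (y ∷ σ) → Decreasing (x ∷ y ∷ σ) ⊎ (x < y × Decreasing (y ∷ σ))
  split dec with <-cmp x y
  ... | tri< x<y _ _ = inj₂ (x<y , dec)
  ... | tri≈ _ x≡y _ = ⊥-elim (x≢y x≡y)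
  ... | tri> _ _ y<x = inj₁ (y<x ∷ dec)
Decreasing-drop-suc (suc k) (x ∷ σ)     (_ ∷ σ!) = Decreasing-drop-suc k σ σ!

Decreasing-drop⇒¬LastAscent : ∀ k σ → Decreasing (drop k σ) → ¬ LastAscent σ (suc k)
Decreasing-drop⇒¬LastAscent zero    (x ∷ y ∷ σ) (y<x ∷ _) (x<y , _) = <-asym x<y y<x
Decreasing-drop⇒¬LastAscent (suc k) (x ∷ σ)     dec       la        = Decreasing-drop⇒¬LastAscent k σ dec la

-- Counting by position of the inserted minimum

WithLastAscent : ℕ → ℕ → Pred (List ℕ) 0ℓ
WithLastAscent k j σ = LastAscentAt σ k × pmp σ ≡ j

withLastAscent? : ∀ k j → Decidable (WithLastAscent k j)
withLastAscent? k j σ = lastAscentAt? σ k ×-dec (pmp σ ≟ j)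

WithLastAscent⇔ : ∀ k j σ → WithLastAscent k j σ ⇔ (LastAscent σ k × pmp σ ≡ j)
WithLastAscent⇔ k j σ = LastAscentAt⇔LastAscent σ k ×-⇔ ⇔.refl

DecreasingFrom : ℕ → ℕ → Pred (List ℕ) 0ℓ
DecreasingFrom t j σ = Decreasing (drop t σ) × pmp σ ≡ j

decreasingFrom? : ∀ t j → Decidable (DecreasingFrom t j)
decreasingFrom? t j σ = decreasing? (drop t σ) ×-dec (pmp σ ≟ j)

#perms-ins-cong : ∀ n i {k j} {Q : Pred (List ℕ) 0ℓ} (Q? : Decidable Q) →
  (∀ {σ} → IsPerm n σ → (LastAscent (ins i σ) k × pmp (ins i σ) ≡ j) ⇔ Q σ) →
  #perms (withLastAscent? k j ∘ ins i) n ≡ #perms Q? n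
#perms-ins-cong n i {k} {j} Q? Q⇔ =
  #perms-cong _ Q? n (λ {σ} σ-perm → ⇔.trans (WithLastAscent⇔ k j (ins i σ)) (Q⇔ σ-perm))

#ins-before : ∀ n k j {i} → i < k → #perms (withLastAscent? (suc k) j ∘ ins i) n ≡ X* (P n k) j
#ins-before n k zero {i} i<k = #perms-empty _ n λ {σ} _ w →
  let la , pmp≡0 = to (WithLastAscent⇔ (suc k) 0 (ins i σ)) w
      la′ = to (LastAscent-ins-before i σ k i<k) la
  in 0≢1+n (trans (sym pmp≡0) (pmp-ins-before la′ i<k))
#ins-before n k (suc j) {i} i<k = #perms-ins-cong n i (withLastAscent? k j) λ {σ} _ → ⇔.trans
  (mk⇔ (λ (la , eq) → let la′ = to (LastAscent-ins-before i σ k i<k) la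
                      in la′ , suc-injective (trans (sym (pmp-ins-before la′ i<k)) eq))
       (λ (la , eq) → from (LastAscent-ins-before i σ k i<k) la , trans (pmp-ins-before la i<k) (cong suc eq)))
  (⇔.sym (WithLastAscent⇔ k j σ))

#ins-at : ∀ n k j → k < n → #perms (withLastAscent? (suc k) j ∘ ins k) n ≡ #perms (decreasingFrom? k j) n
#ins-at n k j k<n = #perms-ins-cong n k (decreasingFrom? k j) λ {σ} (_ , |σ| , _) →
  let k<|σ| = subst (k <_) (sym |σ|) k<n
  in mk⇔ (λ (la , eq) → let dec = to (LastAscent-ins-at k σ k<|σ|) la
                         in dec , trans (sym (pmp-ins-decreasing k σ dec)) eq)
         (λ (dec , eq) → from (LastAscent-ins-at k σ k<|σ|) dec , trans (pmp-ins-decreasing k σ dec) eq)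

#ins-after : ∀ n k j {i} → k ≤ i → i < n → #perms (withLastAscent? k j ∘ ins i) n ≡ 0
#ins-after n k j {i} k≤i i<n = #perms-empty _ n λ {σ} (_ , |σ| , _) (la , _) →
  ¬LastAscent-ins-after k i σ k≤i (subst (i <_) (sym |σ|) i<n) (to (LastAscentAt⇔LastAscent (ins i σ) k) la)

#ins-end : ∀ n k j → #perms (withLastAscent? k j ∘ ins n) n ≡ P n k j
#ins-end n k j = #perms-ins-cong n n (withLastAscent? k j) λ
  { {σ} (_ , refl , _) →
      ⇔.trans (LastAscent-ins-end σ k ×-⇔ pmp-ins-end-≡ σ j) (⇔.sym (WithLastAscent⇔ k j σ)) }

#decreasingFrom-0 : ∀ n j → #perms (decreasingFrom? 0 j) n ≡ 1ₚ j
#decreasingFrom-0 zero    zero    = refl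
#decreasingFrom-0 zero    (suc j) = refl
#decreasingFrom-0 (suc n) j = begin
  #perms (decreasingFrom? 0 j) (suc n)   ≡⟨ #perms-suc (decreasingFrom? 0 j) n ⟩
  sumBelow n G + G n                      ≡⟨ cong₂ _+_ (trans (sumBelow-const G 0 n inner) (*-zeroʳ n)) last ⟩
  1ₚ j                                    ∎
  where
  open ≡-Reasoning
  G : ℕ → ℕ
  G i = #perms (decreasingFrom? 0 j ∘ ins i) n
  inner : ∀ {i} → i < n → G i ≡ 0
  inner {i} i<n = #perms-empty _ n λ {σ} (_ , |σ| , _) (dec , _) →
    ¬Decreasing-ins i σ (subst (i <_) (sym |σ|) i<n) dec
  last : G n ≡ 1ₚ j
  last = trans (#perms-cong _ (decreasingFrom? 0 j) n
                  λ { {σ} (_ , refl , _) → Decreasing-ins-end σ ×-⇔ pmp-ins-end-≡ σ j })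
               (#decreasingFrom-0 n j)

#decreasingFrom-suc : ∀ n t j →
  #perms (decreasingFrom? (suc t) j) n ≡ #perms (decreasingFrom? t j) n + P n (suc t) j
#decreasingFrom-suc n t j = #perms-⊎ (decreasingFrom? (suc t) j) (decreasingFrom? t j) (withLastAscent? (suc t) j) n
  (λ {σ} (σ! , _) → mk⇔
    (λ (dec , eq) → case to (Decreasing-drop-suc t σ σ!) dec of λ where
       (inj₁ dec′) → inj₁ (dec′ , eq)
       (inj₂ la)   → inj₂ (from (LastAscentAt⇔LastAscent σ (suc t)) la , eq))
    (λ where
       (inj₁ (dec , eq)) → from (Decreasing-drop-suc t σ σ!) (inj₁ dec) , eq
       (inj₂ (la , eq))  → from (Decreasing-drop-suc t σ σ!) (inj₂ (to (LastAscentAt⇔LastAscent σ (suc t)) la)) , eq))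
  (λ {σ} _ (dec , _) (la , _) → Decreasing-drop⇒¬LastAscent t σ dec (to (LastAscentAt⇔LastAscent σ (suc t)) la))

#decreasingFrom : ∀ n t j → #perms (decreasingFrom? t j) n ≡ 1ₚ j + Σₚ (range 1 t) (P n) j
#decreasingFrom n zero    j = trans (#decreasingFrom-0 n j) (sym (+-identityʳ (1ₚ j)))
#decreasingFrom n (suc t) j = begin
  #perms (decreasingFrom? (suc t) j) n                    ≡⟨ #decreasingFrom-suc n t j ⟩
  #perms (decreasingFrom? t j) n + P n (suc t) j          ≡⟨ cong (_+ P n (suc t) j) (#decreasingFrom n t j) ⟩
  1ₚ j + Σₚ (range 1 t) (P n) j + P n (suc t) j           ≡⟨ +-assoc (1ₚ j) _ _ ⟩
  1ₚ j + (Σₚ (range 1 t) (P n) j + P n (suc t) j)         ≡⟨ cong (1ₚ j +_) (Σₚ-range-suc (P n) t j) ⟨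
  1ₚ j + Σₚ (range 1 (suc t)) (P n) j                     ∎
  where open ≡-Reasoning

lemma2 : ∀ (n : ℕ) → 2 ≤ n → ∀ (k : ℕ) → 1 ≤ k → k ≤ n ∸ 1 →
    P n k ≈ₚ (k ∸ 1) ·ₚ X* (P (n ∸ 1) (k ∸ 1)) +ₚ 1ₚ +ₚ Σₚ (range 1 k) (λ ℓ → P (n ∸ 1) ℓ)
lemma2 (suc (suc n)) _ (suc k) _ k<1+n j = begin
  P (suc (suc n)) (suc k) j
    ≡⟨ #perms-suc (withLastAscent? (suc k) j) (suc n) ⟩
  sumBelow (suc (suc n)) (λ i → #perms (withLastAscent? (suc k) j ∘ ins i) (suc n))
    ≡⟨ sumBelow-split _ k<1+n (#ins-before (suc n) k j) (#ins-at (suc n) k j k<1+n)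
                        (λ k<i → #ins-after (suc n) (suc k) j k<i) (#ins-end (suc n) (suc k) j) ⟩
  k * X* (P (suc n) k) j + (#perms (decreasingFrom? k j) (suc n) + P (suc n) (suc k) j)
    ≡⟨ cong (k * X* (P (suc n) k) j +_)
            (trans (sym (#decreasingFrom-suc (suc n) k j)) (#decreasingFrom (suc n) (suc k) j)) ⟩
  k * X* (P (suc n) k) j + (1ₚ j + Σₚ (range 1 (suc k)) (P (suc n)) j)
    ≡⟨ +-assoc (k * X* (P (suc n) k) j) (1ₚ j) _ ⟨
  k * X* (P (suc n) k) j + 1ₚ j + Σₚ (range 1 (suc k)) (P (suc n)) j ∎
  where open ≡-Reasoning
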